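{- Let $p$ be a prime and $k\ge 1$ an integer, and let $n=p^k$. Then $n$ is non-intersecting, and every coprime disjoint congruence set of $n$ has density $\dfrac{p^k-1}{p^k(p-1)}$.
   Context: Two congruences $a\bmod d$ and $a'\bmod d'$ overlap if some integer satisfies both. A set of congruences $\{a_1\bmod d_1,\ldots,a_t\bmod d_t\}$ is coprime disjoint (CD) if whenever $a_i\bmod d_i$ and $a_j\bmod d_j$ overlap for $i\neq j$, we have $\gcd(d_i,d_j)=1$. An integer $n$ is non-intersecting if there exist integers $\{a_d : d\mid n,\ d>1\}$ such that $\{a_d\bmod d : d\mid n,\ d>1\}$ is a CD congruence set; such a set is called a CD congruence set of $n$. For a congruence set $A$, let $A(N)$ be the number of positive integers $x\le N$ satisfying some congruence of $A$; the density of $A$ is $\delta(A)=\lim_{N\to\infty}A(N)/N$. -}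

module Defs where

open import Data.Nat as ℕ using (ℕ; zero; suc; _<_; _<?_)
import Data.Nat.Divisibility as ℕD
open import Data.Nat.Coprimality using (Coprime)
open import Data.Integer as ℤ using (ℤ; +_; _-_)
open import Data.Integer.Divisibility.Signed using (_∣_; _∣?_)
open import Data.Rational as ℚ using (ℚ; 0ℚ; _/_)
open import Data.Product using (Σ; ∃; ∃-syntax; _×_; _,_)
open import Data.List using (List; length; filter; upTo; map)
open import Data.List.Relation.Unary.Any using (Any; any?)
open import Relation.Nullary using (¬_; Dec)
open import Relation.Nullary.Decidable using (_×-dec_)
open import Relation.Binary.PropositionalEquality using (_≡_)

-- A congruence family of n: the residue a d is used for the modulus d
-- (only the values at divisors d ∣ n with d > 1 matter).
CongFamily : Set
CongFamily = ℕ → ℤ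

Overlap : ℤ → ℕ → ℤ → ℕ → Set
Overlap a d a' d' = ∃[ x ] ((+ d ∣ (x - a)) × (+ d' ∣ (x - a')))

IsCDSetOf : ℕ → CongFamily → Set
IsCDSetOf n a =
  ∀ d d' → d ℕD.∣ n → d' ℕD.∣ n → 1 < d → 1 < d' → ¬ (d ≡ d') →
  Overlap (a d) d (a d') d' → Coprime d d'

NonIntersecting : ℕ → Set
NonIntersecting n = ∃[ a ] IsCDSetOf n a

Satisfies : ℕ → CongFamily → ℤ → Set
Satisfies n a x = ∃[ d ] (d ℕD.∣ n × 1 < d × (+ d ∣ (x - a d)))

-- Decidable version, searching d over 0 .. n (every divisor of n ≥ 1 is ≤ n).
private
  sat? : (n : ℕ) (a : CongFamily) (x : ℤ) →
         Dec (Any (λ d → d ℕD.∣ n × 1 < d × (+ d ∣ (x - a d))) (upTo (suc n)))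
  sat? n a x = any? (λ d → (d ℕD.∣? n) ×-dec ((1 <? d) ×-dec (+ d ∣? (x - a d)))) (upTo (suc n))

countA : ℕ → CongFamily → ℕ → ℕ
countA n a N = length (filter (λ x → sat? n a (+ x)) (map suc (upTo N)))

-- i / d as a rational, with the (unused) convention i / 0 = 0.
_÷_ : ℤ → ℕ → ℚ
i ÷ zero = 0ℚ
i ÷ suc d = i / suc d

HasDensity : ℕ → CongFamily → ℚ → Set
HasDensity n a δ =
  ∀ (ε : ℚ) → ℚ.0ℚ ℚ.< ε → ∃[ N₀ ] (∀ N → N₀ ℕ.≤ N →
    ℚ.∣ ((+ countA n a N) ÷ N) ℚ.- δ ∣ ℚ.< ε)

-- The divisors d > 1 of n = p^k are the powers p^i (1 ≤ i ≤ k), and any two of them share the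
-- factor p, so a CD congruence set of n is a family of pairwise disjoint classes a_i mod p^i.
-- Such families exist: for a_i = p^(i-1) the i-th class consists of the x exactly divisible by
-- p^(i-1). For any of them, the set of integers satisfying some congruence is n-periodic, and one
-- period meets the i-th class in p^(k-i) points; by disjointness the period contains
-- p^(k-1) + ... + 1 = (p^k - 1)/(p - 1) points, which gives the density.
module Submission where

open import Data.Bool using (true; false)
open import Data.Empty using (⊥; ⊥-elim)
open import Data.Integer as ℤ using (ℤ; +_; +[1+_]; -[1+_]; 1ℤ; _⊖_)
import Data.Integer.Properties as ℤ
import Data.Integer.Divisibility.Signed as ℤ
open import Data.Integer.DivMod using (_%ℕ_; _/ℕ_; n%ℕd<d; a≡a%ℕn+[a/ℕn]*n)
open import Data.Integer.Tactic.RingSolver using (solve-∀)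
import Data.Nat.Tactic.RingSolver as ℕ
open import Data.List using ([]; _∷_; length; filter; upTo; map; _++_)
open import Data.List.Relation.Unary.Any as Any using (Any; any?)
open import Data.List.Membership.Propositional using (lose)
open import Data.List.Membership.Propositional.Properties using (∈-upTo⁺)
open import Data.List.Properties using (upTo-∷ʳ; map-++; length-++; filter-++)
open import Data.Nat
open import Data.Nat.Coprimality using (Coprime; coprime-divisor; gcd≡1⇒coprime)
open import Data.Nat.DivMod using (m≡m%n+[m/n]*n; m%n<n; m*n/n≡m)
open import Data.Nat.Divisibility
open import Data.Nat.GCD using (gcd[m,n]∣m; gcd[m,n]∣n)
open import Data.Nat.Primality using (Prime; prime⇒irreducible; prime⇒nonZero; prime⇒nonTrivial)
open import Data.Nat.Properties
open import Algebra.Properties.CommutativeSemigroup +-commutativeSemigroup using (xy∙z≈xz∙y; interchange)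
open import Algebra.Properties.CommutativeSemigroup *-commutativeSemigroup
  using () renaming (xy∙z≈xz∙y to x*y*z≡x*z*y)
open import Data.Product using (∃-syntax; _×_; _,_; proj₁; proj₂)
open import Data.Rational as ℚ using (ℚ; mkℚ; 0ℚ)
import Data.Rational.Properties as ℚ
open import Data.Rational.Unnormalised as ℚᵘ using (mkℚᵘ; *<*)
import Data.Rational.Unnormalised.Properties as ℚᵘ
open import Data.Sum using (inj₁; inj₂)
open import Function using (_∘_)
open import Level using (0ℓ)
open import Relation.Binary.Definitions using (tri<; tri≈; tri>)
open import Relation.Binary.PropositionalEquality
open import Relation.Nullary using (Dec; yes; no; _because_; ¬_; contradiction)
open import Relation.Nullary.Decidable using (_⊎-dec_; _×-dec_)
open import Relation.Unary using (Pred; Decidable; _⊆_; _≐_; _∩_; _∪_; ∅)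
open import Relation.Unary.Properties using (∅?; _∪?_)

open import Defs

indicator : {A : Set} → Dec A → ℕ
indicator (true because _) = 1
indicator (false because _) = 0

indicator≤1 : {A : Set} (a? : Dec A) → indicator a? ≤ 1
indicator≤1 (true because _) = ≤-refl
indicator≤1 (false because _) = z≤n

indicator-cong : {A B : Set} (a? : Dec A) (b? : Dec B) → (A → B) → (B → A) →
                 indicator a? ≡ indicator b?
indicator-cong (yes _) (yes _) _ _ = refl
indicator-cong (yes a) (no ¬b) f _ = ⊥-elim (¬b (f a))
indicator-cong (no ¬a) (yes b) _ g = ⊥-elim (¬a (g b))
indicator-cong (no _) (no _) _ _ = refl

indicator-yes : {A : Set} (a? : Dec A) → A → indicator a? ≡ 1
indicator-yes (yes _) _ = refl
indicator-yes (no ¬a) a = ⊥-elim (¬a a)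

indicator-no : {A : Set} (a? : Dec A) → ¬ A → indicator a? ≡ 0
indicator-no (yes a) ¬a = ⊥-elim (¬a a)
indicator-no (no _) _ = refl

indicator-⊎ : {A B : Set} (a? : Dec A) (b? : Dec B) → (A → B → ⊥) →
              indicator (a? ⊎-dec b?) ≡ indicator a? + indicator b?
indicator-⊎ (yes a) (yes b) disjoint = ⊥-elim (disjoint a b)
indicator-⊎ (yes _) (no _) _ = refl
indicator-⊎ (no _) (yes _) _ = refl
indicator-⊎ (no _) (no _) _ = refl

count : {P : Pred ℕ 0ℓ} → Decidable P → ℕ → ℕ
count P? zero = 0
count P? (suc N) = count P? N + indicator (P? (suc N))

length-filter-upTo : {P : Pred ℕ 0ℓ} (P? : Decidable P) (N : ℕ) →
                     length (filter P? (map suc (upTo N))) ≡ count P? N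
length-filter-upTo P? zero = refl
length-filter-upTo {P} P? (suc N) = begin
  length (filter P? (map suc (upTo (suc N))))
    ≡⟨ cong (length ∘ filter P? ∘ map suc) (sym (upTo-∷ʳ N)) ⟩
  length (filter P? (map suc (upTo N ++ N ∷ [])))
    ≡⟨ cong (length ∘ filter P?) (map-++ suc (upTo N) (N ∷ [])) ⟩
  length (filter P? (map suc (upTo N) ++ suc N ∷ []))
    ≡⟨ cong length (filter-++ P? (map suc (upTo N)) (suc N ∷ [])) ⟩
  length (filter P? (map suc (upTo N)) ++ filter P? (suc N ∷ []))
    ≡⟨ length-++ (filter P? (map suc (upTo N))) ⟩
  length (filter P? (map suc (upTo N))) + length (filter P? (suc N ∷ []))
    ≡⟨ cong₂ _+_ (length-filter-upTo P? N) (singleton (suc N)) ⟩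
  count P? (suc N) ∎
  where
  open ≡-Reasoning
  singleton : ∀ x → length (filter P? (x ∷ [])) ≡ indicator (P? x)
  singleton x with P? x
  ... | yes _ = refl
  ... | no _ = refl

module _ {P : Pred ℕ 0ℓ} (P? : Decidable P) where

  count≤ : ∀ N → count P? N ≤ N
  count≤ zero = z≤n
  count≤ (suc N) = begin
    count P? N + indicator (P? (suc N)) ≤⟨ +-mono-≤ (count≤ N) (indicator≤1 (P? (suc N))) ⟩
    N + 1                               ≡⟨ +-comm N 1 ⟩
    suc N                               ∎
    where open ≤-Reasoning

  count≡0 : ∀ N → (∀ {x} → 1 ≤ x → x ≤ N → ¬ P x) → count P? N ≡ 0
  count≡0 zero _ = refl
  count≡0 (suc N) none = cong₂ _+_
    (count≡0 N (λ 1≤x x≤N → none 1≤x (m≤n⇒m≤1+n x≤N)))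
    (indicator-no (P? (suc N)) (none (s≤s z≤n) ≤-refl))

  count≡1 : ∀ {x₀} N → P x₀ → 1 ≤ x₀ → x₀ ≤ N → (∀ {x} → 1 ≤ x → x ≤ N → P x → x ≡ x₀) →
            count P? N ≡ 1
  count≡1 zero _ 1≤x₀ x₀≤0 _ = contradiction (≤-trans 1≤x₀ x₀≤0) λ ()
  count≡1 {x₀} (suc N) Px₀ 1≤x₀ x₀≤1+N unique with x₀ ≟ suc N
  ... | yes refl = cong₂ _+_
    (count≡0 N (λ 1≤x x≤N Px → <⇒≢ (s≤s x≤N) (unique 1≤x (m≤n⇒m≤1+n x≤N) Px)))
    (indicator-yes (P? (suc N)) Px₀)
  ... | no x₀≢1+N = cong₂ _+_
    (count≡1 N Px₀ 1≤x₀ x₀≤N (λ 1≤x x≤N → unique 1≤x (m≤n⇒m≤1+n x≤N)))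
    (indicator-no (P? (suc N)) (λ P1+N → x₀≢1+N (sym (unique (s≤s z≤n) ≤-refl P1+N))))
    where x₀≤N = ≤-pred (≤∧≢⇒< x₀≤1+N x₀≢1+N)

count-cong : {P Q : Pred ℕ 0ℓ} (P? : Decidable P) (Q? : Decidable Q) → P ≐ Q →
             ∀ N → count P? N ≡ count Q? N
count-cong P? Q? P≐Q zero = refl
count-cong P? Q? P≐Q@(P⊆Q , Q⊆P) (suc N) =
  cong₂ _+_ (count-cong P? Q? P≐Q N) (indicator-cong (P? (suc N)) (Q? (suc N)) P⊆Q Q⊆P)

count-∪ : {P Q : Pred ℕ 0ℓ} (P? : Decidable P) (Q? : Decidable Q) → P ∩ Q ⊆ ∅ →
          ∀ N → count (P? ∪? Q?) N ≡ count P? N + count Q? N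
count-∪ P? Q? disjoint zero = refl
count-∪ P? Q? disjoint (suc N) = begin
  count (P? ∪? Q?) N + indicator (P? (suc N) ⊎-dec Q? (suc N))
    ≡⟨ cong₂ _+_ (count-∪ P? Q? disjoint N)
                 (indicator-⊎ (P? (suc N)) (Q? (suc N)) (λ p q → disjoint (p , q))) ⟩
  (count P? N + count Q? N) + (indicator (P? (suc N)) + indicator (Q? (suc N)))
    ≡⟨ interchange (count P? N) (count Q? N) _ _ ⟩
  count P? (suc N) + count Q? (suc N) ∎
  where open ≡-Reasoning

Periodic : ℕ → Pred ℕ 0ℓ → Set
Periodic n P = P ≐ (P ∘ (_+ n))

module _ {P : Pred ℕ 0ℓ} (P? : Decidable P) {n} (periodic : Periodic n P) where

  count-+-period : ∀ N → count P? (N + n) ≡ count P? N + count P? n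
  count-+-period zero = refl
  count-+-period (suc N) = begin
    count P? (N + n) + indicator (P? (suc N + n))
      ≡⟨ cong₂ _+_ (count-+-period N)
                   (indicator-cong (P? (suc N + n)) (P? (suc N)) (proj₂ periodic) (proj₁ periodic)) ⟩
    count P? N + count P? n + indicator (P? (suc N))
      ≡⟨ xy∙z≈xz∙y (count P? N) (count P? n) _ ⟩
    count P? (suc N) + count P? n ∎
    where open ≡-Reasoning

  count-*-period : ∀ q → count P? (q * n) ≡ q * count P? n
  count-*-period zero = refl
  count-*-period (suc q) = begin
    count P? (n + q * n)        ≡⟨ cong (count P?) (+-comm n (q * n)) ⟩
    count P? (q * n + n)        ≡⟨ count-+-period (q * n) ⟩
    count P? (q * n) + count P? n ≡⟨ cong (_+ count P? n) (count-*-period q) ⟩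
    q * count P? n + count P? n ≡⟨ +-comm (q * count P? n) _ ⟩
    suc q * count P? n          ∎
    where open ≡-Reasoning

module _ {P : Pred ℕ 0ℓ} (P? : Decidable P) (n : ℕ) .{{_ : NonZero n}} (periodic : Periodic n P) where

  private
    F = count P?

    error : ℕ → ℕ
    error X = ∣ F X * n - F n * X ∣

    error-+-period : ∀ X → error (X + n) ≡ error X
    error-+-period X = begin
      ∣ F (X + n) * n - F n * (X + n) ∣
        ≡⟨ cong₂ (λ u v → ∣ u * n - v ∣) (count-+-period P? periodic X) (*-distribˡ-+ (F n) X n) ⟩
      ∣ (F X + F n) * n - (F n * X + F n * n) ∣
        ≡⟨ cong₂ ∣_-_∣ (trans (*-distribʳ-+ n (F X) (F n)) (+-comm (F X * n) _)) (+-comm (F n * X) _) ⟩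
      ∣ F n * n + F X * n - (F n * n + F n * X) ∣
        ≡⟨ ∣m+n-m+o∣≡∣n-o∣ (F n * n) _ _ ⟩
      error X ∎
      where open ≡-Reasoning

    error-*-period : ∀ X q → error (X + q * n) ≡ error X
    error-*-period X zero = cong error (+-identityʳ X)
    error-*-period X (suc q) = begin
      error (X + (n + q * n)) ≡⟨ cong (λ y → error (X + y)) (+-comm n (q * n)) ⟩
      error (X + (q * n + n)) ≡⟨ cong error (sym (+-assoc X (q * n) n)) ⟩
      error (X + q * n + n)   ≡⟨ error-+-period (X + q * n) ⟩
      error (X + q * n)       ≡⟨ error-*-period X q ⟩
      error X                 ∎
      where open ≡-Reasoning

    error-within-period : ∀ r → r < n → error r ≤ n * n
    error-within-period r r<n = ≤-trans (∣m-n∣≤m⊔n (F r * n) (F n * r)) (⊔-lub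
      (*-monoˡ-≤ n (≤-trans (count≤ P? r) (<⇒≤ r<n)))
      (*-mono-≤ (count≤ P? n) (<⇒≤ r<n)))

  count-period-error : ∀ N → ∣ count P? N * n - count P? n * N ∣ ≤ n * n
  count-period-error N = begin
    error N                   ≡⟨ cong error (m≡m%n+[m/n]*n N n) ⟩
    error (N % n + (N / n) * n) ≡⟨ error-*-period (N % n) (N / n) ⟩
    error (N % n)             ≤⟨ error-within-period (N % n) (m%n<n N n) ⟩
    n * n                     ∎
    where open ≤-Reasoning

∣⊖∣≡∣-∣ : ∀ m n → ℤ.∣ m ⊖ n ∣ ≡ ∣ m - n ∣
∣⊖∣≡∣-∣ m n with ≤-total m n
... | inj₁ m≤n = trans (ℤ.∣⊖∣-≤ m≤n) (sym (m≤n⇒∣m-n∣≡n∸m m≤n))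
... | inj₂ n≤m = begin
  ℤ.∣ m ⊖ n ∣ ≡⟨ ℤ.∣m⊖n∣≡∣n⊖m∣ m n ⟩
  ℤ.∣ n ⊖ m ∣ ≡⟨ ℤ.∣⊖∣-≤ n≤m ⟩
  m ∸ n       ≡⟨ sym (m≤n⇒∣m-n∣≡n∸m n≤m) ⟩
  ∣ n - m ∣   ≡⟨ ∣-∣-comm n m ⟩
  ∣ m - n ∣   ∎
  where open ≡-Reasoning

ConvergesTo : (ℕ → ℚ) → ℚ → Set
ConvergesTo f δ =
  ∀ (ε : ℚ) → 0ℚ ℚ.< ε → ∃[ N₀ ] (∀ N → N₀ ≤ N → ℚ.∣ f N ℚ.- δ ∣ ℚ.< ε)

private
  toℚᵘ-/ : ∀ i x → ℚ.toℚᵘ (i ℚ./ suc x) ℚᵘ.≃ mkℚᵘ i x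
  toℚᵘ-/ i x = ℚ.toℚᵘ-fromℚᵘ (mkℚᵘ i x)

  toℚᵘ-∣/-/∣ : ∀ i x j y →
               ℚ.toℚᵘ ℚ.∣ i ℚ./ suc x ℚ.- j ℚ./ suc y ∣ ℚᵘ.≃ ℚᵘ.∣ mkℚᵘ i x ℚᵘ.- mkℚᵘ j y ∣
  toℚᵘ-∣/-/∣ i x j y = begin
    ℚ.toℚᵘ ℚ.∣ u ℚ.- v ∣                ≈⟨ ℚ.toℚᵘ-homo-∣-∣ (u ℚ.- v) ⟩
    ℚᵘ.∣ ℚ.toℚᵘ (u ℚ.- v) ∣             ≈⟨ ℚᵘ.∣-∣-cong (ℚ.toℚᵘ-homo-+ u (ℚ.- v)) ⟩
    ℚᵘ.∣ ℚ.toℚᵘ u ℚᵘ.+ ℚ.toℚᵘ (ℚ.- v) ∣ ≈⟨ ℚᵘ.∣-∣-cong (ℚᵘ.+-cong (toℚᵘ-/ i x) toℚᵘ[-v]≃-mkℚᵘ) ⟩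
    ℚᵘ.∣ mkℚᵘ i x ℚᵘ.- mkℚᵘ j y ∣       ∎
    where
    open ℚᵘ.≃-Reasoning
    u = i ℚ./ suc x
    v = j ℚ./ suc y
    toℚᵘ[-v]≃-mkℚᵘ : ℚ.toℚᵘ (ℚ.- v) ℚᵘ.≃ ℚᵘ.- mkℚᵘ j y
    toℚᵘ[-v]≃-mkℚᵘ = ℚᵘ.≃-trans (ℚ.toℚᵘ-homo‿- v) (ℚᵘ.-‿cong (toℚᵘ-/ j y))

  ∣+a*+s-+b*+t∣ : ∀ a s b t → ℤ.∣ + a ℤ.* + s ℤ.+ ℤ.- + b ℤ.* + t ∣ ≡ ∣ a * s - b * t ∣
  ∣+a*+s-+b*+t∣ a s b t = begin
    ℤ.∣ + a ℤ.* + s ℤ.+ ℤ.- + b ℤ.* + t ∣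
      ≡⟨ cong₂ (λ u v → ℤ.∣ u ℤ.+ v ∣) (sym (ℤ.pos-* a s))
                (trans (sym (ℤ.neg-distribˡ-* (+ b) (+ t))) (cong ℤ.-_ (sym (ℤ.pos-* b t)))) ⟩
    ℤ.∣ + (a * s) ℤ.+ ℤ.- + (b * t) ∣ ≡⟨ cong ℤ.∣_∣ (ℤ.m-n≡m⊖n (a * s) (b * t)) ⟩
    ℤ.∣ a * s ⊖ b * t ∣              ≡⟨ ∣⊖∣≡∣-∣ (a * s) (b * t) ⟩
    ∣ a * s - b * t ∣                ∎
    where open ≡-Reasoning

  ∣/-/∣< : ∀ a x b y e d .(cop : Coprime (suc e) (suc d)) →
           ∣ a * suc y - b * suc x ∣ * suc d < suc e * (suc x * suc y) →
           ℚ.∣ + a ℚ./ suc x ℚ.- + b ℚ./ suc y ∣ ℚ.< mkℚ +[1+ e ] d cop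
  ∣/-/∣< a x b y e d cop ineq =
    ℚ.toℚᵘ-cancel-< (ℚᵘ.<-respˡ-≃ (ℚᵘ.≃-sym (toℚᵘ-∣/-/∣ (+ a) x (+ b) y)) (*<* ineqℤ))
    where
    ∣a[1+y]-b[1+x]∣ = ℤ.∣ + a ℤ.* + suc y ℤ.+ ℤ.- + b ℤ.* + suc x ∣
    ineqℤ : + ∣a[1+y]-b[1+x]∣ ℤ.* + suc d ℤ.< +[1+ e ] ℤ.* + (suc x * suc y)
    ineqℤ = subst₂ ℤ._<_
      (trans (cong (λ z → + (z * suc d)) (sym (∣+a*+s-+b*+t∣ a (suc y) b (suc x))))
             (ℤ.pos-* ∣a[1+y]-b[1+x]∣ (suc d)))
      (ℤ.pos-* (suc e) (suc x * suc y))
      (ℤ.+<+ ineq)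

ratio-converges : (F : ℕ → ℕ) (c m B : ℕ) → 0 < m → (∀ N → ∣ F N * m - c * N ∣ ≤ B) →
                  ConvergesTo (λ N → (+ F N) ÷ N) ((+ c) ÷ m)
ratio-converges F c (suc m) B _ bounded (mkℚ (+ 0) _ _) 0<ε with () ← ℚ.positive 0<ε
ratio-converges F c (suc m) B _ bounded (mkℚ -[1+ _ ] _ _) 0<ε with () ← ℚ.positive 0<ε
-- For ε = (1 + e) / (1 + d): |F N / N - c / m| = |F N * m - c * N| / (N * m) ≤ B / N < 1 / (1 + d)
-- as soon as N > B (1 + d).
ratio-converges F c (suc m) B _ bounded (mkℚ +[1+ e ] d cop) _ = suc (B * suc d) , close
  where
  close : ∀ N → suc (B * suc d) ≤ N →
          ℚ.∣ (+ F N) ÷ N ℚ.- (+ c) ÷ suc m ∣ ℚ.< mkℚ +[1+ e ] d cop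
  close (suc N) (s≤s B[1+d]≤N) = ∣/-/∣< (F (suc N)) N c m e d cop (begin-strict
    ∣ F (suc N) * suc m - c * suc N ∣ * suc d ≤⟨ *-monoˡ-≤ (suc d) (bounded (suc N)) ⟩
    B * suc d                                 ≤⟨ B[1+d]≤N ⟩
    N                                         <⟨ n<1+n N ⟩
    suc N                                     ≤⟨ m≤m*n (suc N) (suc m) ⟩
    suc N * suc m                             ≤⟨ m≤n*m (suc N * suc m) (suc e) ⟩
    suc e * (suc N * suc m)                   ∎)
    where open ≤-Reasoning

ConvergesTo-cong : ∀ {f g δ} → (∀ N → f N ≡ g N) → ConvergesTo f δ → ConvergesTo g δ
ConvergesTo-cong {f} {g} {δ} f≗g f→δ ε 0<ε =
  let N₀ , close = f→δ ε 0<ε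
  in N₀ , λ N N₀≤N → subst (λ z → ℚ.∣ z ℚ.- δ ∣ ℚ.< ε) (f≗g N) (close N N₀≤N)

periodic-density : {P : Pred ℕ 0ℓ} (P? : Decidable P) {n : ℕ} .{{_ : NonZero n}} → Periodic n P →
                   ∀ {q c} → 0 < q → count P? n * q ≡ c →
                   ConvergesTo (λ N → (+ count P? N) ÷ N) ((+ c) ÷ (n * q))
periodic-density P? {n} periodic {q} {c} 0<q count[n]*q≡c =
  ratio-converges (count P?) c (n * q) (n * n * q) (*-mono-≤ (>-nonZero⁻¹ n) 0<q) bounded
  where
  bounded : ∀ N → ∣ count P? N * (n * q) - c * N ∣ ≤ n * n * q
  bounded N = begin
    ∣ count P? N * (n * q) - c * N ∣
      ≡⟨ cong₂ ∣_-_∣ (sym (*-assoc (count P? N) n q))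
                    (trans (cong (_* N) (sym count[n]*q≡c)) (x*y*z≡x*z*y (count P? n) q N)) ⟩
    ∣ count P? N * n * q - count P? n * N * q ∣ ≡⟨ sym (*-distribʳ-∣-∣ q (count P? N * n) _) ⟩
    ∣ count P? N * n - count P? n * N ∣ * q     ≤⟨ *-monoˡ-≤ q (count-period-error P? n periodic N) ⟩
    n * n * q                                   ∎
    where open ≤-Reasoning

ResidueClass : ℤ → ℕ → Pred ℕ 0ℓ
ResidueClass A d x = + d ℤ.∣ (+ x ℤ.- A)

residueClass? : ∀ A d → Decidable (ResidueClass A d)
residueClass? A d x = + d ℤ.∣? (+ x ℤ.- A)

residueClass-periodic : ∀ {A d n} → d ∣ n → Periodic n (ResidueClass A d)
residueClass-periodic {A} {d} {n} d∣n = shift , unshift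
  where
  x+n-A≡x-A+n : ∀ x → + (x + n) ℤ.- A ≡ (+ x ℤ.- A) ℤ.+ + n
  x+n-A≡x-A+n x = trans (cong (ℤ._- A) (ℤ.pos-+ x n)) (identity (+ x) A (+ n))
    where
    identity : ∀ x A n → (x ℤ.+ n) ℤ.- A ≡ (x ℤ.- A) ℤ.+ n
    identity = solve-∀

  shift : ∀ {x} → ResidueClass A d x → ResidueClass A d (x + n)
  shift {x} d∣x-A = subst (+ d ℤ.∣_) (sym (x+n-A≡x-A+n x)) (ℤ.∣m∣n⇒∣m+n d∣x-A (ℤ.∣ᵤ⇒∣ d∣n))

  unshift : ∀ {x} → ResidueClass A d (x + n) → ResidueClass A d x
  unshift {x} d∣x+n-A = ℤ.∣m+n∣n⇒∣m (subst (+ d ℤ.∣_) (x+n-A≡x-A+n x) d∣x+n-A) (ℤ.∣ᵤ⇒∣ d∣n)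

module _ (A : ℤ) (d : ℕ) .{{_ : NonZero d}} where

  private
    representative : ℕ
    representative = suc ((A ℤ.- 1ℤ) %ℕ d)

    representative≤d : representative ≤ d
    representative≤d = n%ℕd<d (A ℤ.- 1ℤ) d

    representative-∈ : ResidueClass A d representative
    representative-∈ = ℤ.divides (ℤ.- q) (begin
      + suc r ℤ.- A            ≡⟨ identity₁ (+ r) A ⟩
      + r ℤ.- (A ℤ.- 1ℤ)       ≡⟨ cong (λ z → + r ℤ.- z) (a≡a%ℕn+[a/ℕn]*n (A ℤ.- 1ℤ) d) ⟩
      + r ℤ.- (+ r ℤ.+ q ℤ.* + d) ≡⟨ identity₂ (+ r) q (+ d) ⟩
      ℤ.- q ℤ.* + d            ∎)
      where
      open ≡-Reasoning
      r = (A ℤ.- 1ℤ) %ℕ d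
      q = (A ℤ.- 1ℤ) /ℕ d
      identity₁ : ∀ r A → (1ℤ ℤ.+ r) ℤ.- A ≡ r ℤ.- (A ℤ.- 1ℤ)
      identity₁ = solve-∀
      identity₂ : ∀ r q d → r ℤ.- (r ℤ.+ q ℤ.* d) ≡ ℤ.- q ℤ.* d
      identity₂ = solve-∀

    ∣≡0 : ∀ {t} → d ∣ t → t < d → t ≡ 0
    ∣≡0 {zero} _ _ = refl
    ∣≡0 {suc t} d∣t t<d = contradiction d∣t (>⇒∤ t<d)

    unique-representative : ∀ {x y} → 1 ≤ x → x ≤ d → 1 ≤ y → y ≤ d →
                            ResidueClass A d x → ResidueClass A d y → x ≡ y
    unique-representative {suc x} {suc y} _ (s≤s x<d) _ (s≤s y<d) x≡A y≡A =
      ∣m-n∣≡0⇒m≡n (∣≡0 d∣x-y ∣x-y∣<d)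
      where
      identity : ∀ x y A → (x ℤ.- A) ℤ.- (y ℤ.- A) ≡ x ℤ.- y
      identity = solve-∀
      d∣x-y : d ∣ ∣ suc x - suc y ∣
      d∣x-y = subst (d ∣_) (trans (cong ℤ.∣_∣ (ℤ.m-n≡m⊖n (suc x) (suc y))) (∣⊖∣≡∣-∣ (suc x) (suc y)))
                (ℤ.∣⇒∣ᵤ (subst (+ d ℤ.∣_) (identity (+ suc x) (+ suc y) A) (ℤ.∣m∣n⇒∣m-n x≡A y≡A)))
      ∣x-y∣<d : ∣ suc x - suc y ∣ < d
      ∣x-y∣<d = s≤s (≤-trans (∣m-n∣≤m⊔n x y) (⊔-lub x<d y<d))

  count-residueClass : ∀ q → count (residueClass? A d) (q * d) ≡ q
  count-residueClass q = begin
    count (residueClass? A d) (q * d)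
      ≡⟨ count-*-period (residueClass? A d) (residueClass-periodic {A} ∣-refl) q ⟩
    q * count (residueClass? A d) d   ≡⟨ cong (q *_) one-per-period ⟩
    q * 1                             ≡⟨ *-identityʳ q ⟩
    q                                 ∎
    where
    open ≡-Reasoning
    one-per-period : count (residueClass? A d) d ≡ 1
    one-per-period = count≡1 (residueClass? A d) d representative-∈ (s≤s z≤n) representative≤d
      λ 1≤x x≤d x≡A → unique-representative 1≤x x≤d (s≤s z≤n) representative≤d x≡A representative-∈

^-monoʳ-∣ : ∀ m {i j} → i ≤ j → m ^ i ∣ m ^ j
^-monoʳ-∣ m {i} {j} i≤j = divides (m ^ (j ∸ i)) (begin
  m ^ j             ≡⟨ cong (m ^_) (sym (m∸n+n≡m i≤j)) ⟩
  m ^ (j ∸ i + i)   ≡⟨ ^-distribˡ-+-* m (j ∸ i) i ⟩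
  m ^ (j ∸ i) * m ^ i ∎)
  where open ≡-Reasoning

^-injectiveʳ : ∀ {m i j} → 1 < m → m ^ i ≡ m ^ j → i ≡ j
^-injectiveʳ {m} {i} {j} 1<m mⁱ≡mʲ with <-cmp i j
... | tri< i<j _ _ = contradiction mⁱ≡mʲ (<⇒≢ (^-monoʳ-< m 1<m i<j))
... | tri≈ _ i≡j _ = i≡j
... | tri> _ _ i>j = contradiction (sym mⁱ≡mʲ) (<⇒≢ (^-monoʳ-< m 1<m i>j))

¬coprime-^ : ∀ {m i j} → 1 < m → 1 ≤ i → 1 ≤ j → ¬ Coprime (m ^ i) (m ^ j)
¬coprime-^ {m} 1<m 1≤i 1≤j coprime = <⇒≢ 1<m (sym (coprime (m∣m^i 1≤i , m∣m^i 1≤j)))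
  where
  m∣m^i : ∀ {i} → 1 ≤ i → m ∣ m ^ i
  m∣m^i {i} 1≤i = subst (_∣ m ^ i) (*-identityʳ m) (^-monoʳ-∣ m 1≤i)

exact-power-classes-disjoint : ∀ {m i j} (x : ℤ) → 1 < m → i < j →
  + m ^ suc i ℤ.∣ x ℤ.- + m ^ i → + m ^ suc j ℤ.∣ x ℤ.- + m ^ j → ⊥
exact-power-classes-disjoint {m@(suc _)} {i} {j} x 1<m i<j x≡mⁱ x≡mʲ =
  <⇒≱ (^-monoʳ-< m 1<m (n<1+n i)) (∣⇒≤ {{m^n≢0 m i}} (ℤ.∣⇒∣ᵤ m^[1+i]∣m^i))
  where
  identity : ∀ x b c → ((x ℤ.- b) ℤ.+ b) ℤ.- (x ℤ.- c) ≡ c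
  identity = solve-∀
  m^[1+i]∣m^j : + m ^ suc i ℤ.∣ + m ^ j
  m^[1+i]∣m^j = ℤ.∣ᵤ⇒∣ (^-monoʳ-∣ m i<j)
  m^[1+i]∣x-m^j : + m ^ suc i ℤ.∣ x ℤ.- + m ^ j
  m^[1+i]∣x-m^j = ℤ.∣-trans (ℤ.∣ᵤ⇒∣ (^-monoʳ-∣ m (m≤n⇒m≤1+n i<j))) x≡mʲ
  m^[1+i]∣m^i : + m ^ suc i ℤ.∣ + m ^ i
  m^[1+i]∣m^i = subst (+ m ^ suc i ℤ.∣_) (identity x (+ m ^ j) (+ m ^ i))
    (ℤ.∣m∣n⇒∣m-n (ℤ.∣m∣n⇒∣m+n m^[1+i]∣x-m^j m^[1+i]∣m^j) x≡mⁱ)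

-- Mirrors the bounded search over d ≤ n inside countA, so that countA≡count needs only the filter lemma.
SatisfiesSome : ℕ → CongFamily → Pred ℕ 0ℓ
SatisfiesSome n a x = Any (λ d → d ∣ n × 1 < d × ResidueClass (a d) d x) (upTo (suc n))

satisfiesSome? : ∀ n a → Decidable (SatisfiesSome n a)
satisfiesSome? n a x =
  any? (λ d → (d ∣? n) ×-dec ((1 <? d) ×-dec residueClass? (a d) d x)) (upTo (suc n))

countA≡count : ∀ n a N → countA n a N ≡ count (satisfiesSome? n a) N
countA≡count n a = length-filter-upTo (satisfiesSome? n a)

satisfiesSome-periodic : ∀ {n a} → Periodic n (SatisfiesSome n a)
satisfiesSome-periodic {n} {a} =
  Any.map (λ {d} (d∣n , 1<d , x∈class) → d∣n , 1<d , proj₁ (residueClass-periodic {a d} d∣n) x∈class) ,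
  Any.map (λ {d} (d∣n , 1<d , x∈class) → d∣n , 1<d , proj₂ (residueClass-periodic {a d} d∣n) x∈class)

module _ {p : ℕ} (p-prime : Prime p) where

  private instance
    p≢0 = prime⇒nonZero p-prime

  ∣p^k⇒≡p^i : ∀ {d} k → d ∣ p ^ k → ∃[ i ] (i ≤ k × d ≡ p ^ i)
  ∣p^k⇒≡p^i zero d∣1 = 0 , z≤n , ∣1⇒≡1 d∣1
  ∣p^k⇒≡p^i {d} (suc k) d∣p^[1+k] with p ∣? d
  ... | no p∤d =
    let i , i≤k , d≡p^i = ∣p^k⇒≡p^i k (coprime-divisor (coprime-to-p p∤d) d∣p^[1+k])
    in i , m≤n⇒m≤1+n i≤k , d≡p^i
    where
    coprime-to-p : ¬ p ∣ d → Coprime d p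
    coprime-to-p p∤d with prime⇒irreducible p-prime (gcd[m,n]∣n d p)
    ... | inj₁ gcd≡1 = gcd≡1⇒coprime gcd≡1
    ... | inj₂ gcd≡p = contradiction (subst (_∣ d) gcd≡p (gcd[m,n]∣m d p)) p∤d
  ... | yes (divides q refl) =
    let q∣p^k = *-cancelʳ-∣ {q} p (subst (q * p ∣_) (*-comm p (p ^ k)) d∣p^[1+k])
        i , i≤k , q≡p^i = ∣p^k⇒≡p^i k q∣p^k
    in suc i , s≤s i≤k , trans (cong (_* p) q≡p^i) (*-comm (p ^ i) p)

  1<p : 1 < p
  1<p = nonTrivial⇒n>1 p {{prime⇒nonTrivial p-prime}}

  1<p^i : ∀ {i} → 1 ≤ i → 1 < p ^ i
  1<p^i = ^-monoʳ-< p 1<p {0}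

  -- x ≡ p^i (mod p^(i+1)) says that p^i divides x exactly.
  a₀ : CongFamily
  a₀ d = + (d / p)

  a₀-class : ∀ i x → + p ^ suc i ℤ.∣ x ℤ.- a₀ (p ^ suc i) → + p ^ suc i ℤ.∣ x ℤ.- + p ^ i
  a₀-class i x = subst (λ A → + p ^ suc i ℤ.∣ x ℤ.- A)
    (cong +_ (trans (cong (_/ p) (*-comm p (p ^ i))) (m*n/n≡m (p ^ i) p)))

  a₀-isCD : ∀ k → IsCDSetOf (p ^ k) a₀
  a₀-isCD k d d' d∣p^k d'∣p^k 1<d 1<d' d≢d' (x , x≡a₀[d] , x≡a₀[d'])
    with ∣p^k⇒≡p^i k d∣p^k | ∣p^k⇒≡p^i k d'∣p^k
  ... | zero , _ , refl | _ = contradiction 1<d (<-irrefl refl)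
  ... | _ | zero , _ , refl = contradiction 1<d' (<-irrefl refl)
  ... | suc i , _ , refl | suc j , _ , refl with <-cmp i j
  ...   | tri< i<j _ _ =
    ⊥-elim (exact-power-classes-disjoint x 1<p i<j (a₀-class i x x≡a₀[d]) (a₀-class j x x≡a₀[d']))
  ...   | tri≈ _ refl _ = contradiction refl d≢d'
  ...   | tri> _ _ j<i =
    ⊥-elim (exact-power-classes-disjoint x 1<p j<i (a₀-class j x x≡a₀[d']) (a₀-class i x x≡a₀[d]))

  module CDSetOfPrimePower (k : ℕ) (a : CongFamily) where

    Class : ℕ → Pred ℕ 0ℓ
    Class i = ResidueClass (a (p ^ i)) (p ^ i)

    class? : ∀ i → Decidable (Class i)
    class? i = residueClass? (a (p ^ i)) (p ^ i)

    ClassesUpTo : ℕ → Pred ℕ 0ℓ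
    ClassesUpTo zero = ∅
    ClassesUpTo (suc j) = ClassesUpTo j ∪ Class (suc j)

    classesUpTo? : ∀ j → Decidable (ClassesUpTo j)
    classesUpTo? zero = ∅?
    classesUpTo? (suc j) = classesUpTo? j ∪? class? (suc j)

    ClassesUpTo⇒Class : ∀ {j x} → ClassesUpTo j x → ∃[ i ] (1 ≤ i × i ≤ j × Class i x)
    ClassesUpTo⇒Class {suc j} (inj₁ x∈Sⱼ) =
      let i , 1≤i , i≤j , x∈Cᵢ = ClassesUpTo⇒Class x∈Sⱼ in i , 1≤i , m≤n⇒m≤1+n i≤j , x∈Cᵢ
    ClassesUpTo⇒Class {suc j} (inj₂ x∈Cⱼ₊₁) = suc j , s≤s z≤n , ≤-refl , x∈Cⱼ₊₁

    Class⇒ClassesUpTo : ∀ {i j x} → 1 ≤ i → i ≤ j → Class i x → ClassesUpTo j x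
    Class⇒ClassesUpTo {i} {zero} 1≤i i≤0 _ = contradiction (≤-trans 1≤i i≤0) λ ()
    Class⇒ClassesUpTo {i} {suc j} 1≤i i≤1+j x∈Cᵢ with i ≟ suc j
    ... | yes refl = inj₂ x∈Cᵢ
    ... | no i≢1+j = inj₁ (Class⇒ClassesUpTo 1≤i (≤-pred (≤∧≢⇒< i≤1+j i≢1+j)) x∈Cᵢ)

    satisfiesSome≐classesUpTo : SatisfiesSome (p ^ k) a ≐ ClassesUpTo k
    satisfiesSome≐classesUpTo = classes , satisfies
      where
      classes : SatisfiesSome (p ^ k) a ⊆ ClassesUpTo k
      classes x∈A with d , d∣p^k , 1<d , x∈class ← Any.satisfied x∈A | ∣p^k⇒≡p^i k d∣p^k
      ... | zero , _ , refl = contradiction 1<d (<-irrefl refl)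
      ... | suc i , 1+i≤k , refl = Class⇒ClassesUpTo {suc i} {k} (s≤s z≤n) 1+i≤k x∈class
      satisfies : ClassesUpTo k ⊆ SatisfiesSome (p ^ k) a
      satisfies x∈Sₖ =
        let i , 1≤i , i≤k , x∈Cᵢ = ClassesUpTo⇒Class {k} x∈Sₖ
            p^i∣p^k = ^-monoʳ-∣ p i≤k
        in lose (∈-upTo⁺ (s≤s (∣⇒≤ {{m^n≢0 p k}} p^i∣p^k))) (p^i∣p^k , 1<p^i 1≤i , x∈Cᵢ)

    count-class : ∀ {i l} → i + l ≡ k → count (class? i) (p ^ k) ≡ p ^ l
    count-class {i} {l} i+l≡k = begin
      count (class? i) (p ^ k)
        ≡⟨ cong (count _) (trans (cong (p ^_) (trans (sym i+l≡k) (+-comm i l))) (^-distribˡ-+-* p l i)) ⟩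
      count (class? i) (p ^ l * p ^ i)
        ≡⟨ count-residueClass (a (p ^ i)) (p ^ i) {{m^n≢0 p i}} (p ^ l) ⟩
      p ^ l ∎
      where open ≡-Reasoning

    module _ (cd : IsCDSetOf (p ^ k) a) where

      classes-disjoint : ∀ {j} → suc j ≤ k → ClassesUpTo j ∩ Class (suc j) ⊆ ∅
      classes-disjoint {j} 1+j≤k {x} (x∈Sⱼ , x∈Cⱼ₊₁) =
        let i , 1≤i , i≤j , x∈Cᵢ = ClassesUpTo⇒Class x∈Sⱼ in
        ¬coprime-^ {j = suc j} 1<p 1≤i (s≤s z≤n) (cd (p ^ i) (p ^ suc j)
          (^-monoʳ-∣ p (≤-trans (m≤n⇒m≤1+n i≤j) 1+j≤k)) (^-monoʳ-∣ p 1+j≤k)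
          (1<p^i 1≤i) (1<p^i {suc j} (s≤s z≤n))
          (λ p^i≡p^[1+j] → <⇒≢ (s≤s i≤j) (^-injectiveʳ {i = i} {j = suc j} 1<p p^i≡p^[1+j]))
          (+ x , x∈Cᵢ , x∈Cⱼ₊₁))

      -- The period contains p^(k-1) + ... + p^(k-j) points of the first j classes; the identity is
      -- stated multiplied by p - 1, where it telescopes without division.
      count-classesUpTo : ∀ {j l} → j + l ≡ k →
                          count (classesUpTo? j) (p ^ k) * (p ∸ 1) + p ^ l ≡ p ^ k
      count-classesUpTo {zero} {l} l≡k =
        cong₂ (λ c m → c * (p ∸ 1) + p ^ m) (count≡0 ∅? (p ^ k) (λ _ _ ())) l≡k
      count-classesUpTo {suc j} {l} 1+j+l≡k = begin
        count (classesUpTo? j ∪? class? (suc j)) (p ^ k) * (p ∸ 1) + p ^ l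
          ≡⟨ cong (λ c → c * (p ∸ 1) + p ^ l) (count-∪ (classesUpTo? j) (class? (suc j)) disjoint (p ^ k)) ⟩
        (Sⱼ + count (class? (suc j)) (p ^ k)) * (p ∸ 1) + p ^ l
          ≡⟨ cong (λ c → (Sⱼ + c) * (p ∸ 1) + p ^ l) (count-class {suc j} {l} 1+j+l≡k) ⟩
        (Sⱼ + p ^ l) * (p ∸ 1) + p ^ l   ≡⟨ identity Sⱼ (p ^ l) (p ∸ 1) ⟩
        Sⱼ * (p ∸ 1) + suc (p ∸ 1) * p ^ l ≡⟨ cong (λ q → Sⱼ * (p ∸ 1) + q * p ^ l) (suc-pred p) ⟩
        Sⱼ * (p ∸ 1) + p ^ suc l         ≡⟨ count-classesUpTo {j} {suc l} (trans (+-suc j l) 1+j+l≡k) ⟩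
        p ^ k                            ∎
        where
        open ≡-Reasoning
        Sⱼ = count (classesUpTo? j) (p ^ k)
        disjoint = classes-disjoint (subst (suc j ≤_) 1+j+l≡k (m≤m+n (suc j) l))
        identity : ∀ c L q → (c + L) * q + L ≡ c * q + suc q * L
        identity = ℕ.solve-∀

      count-satisfiesSome : count (satisfiesSome? (p ^ k) a) (p ^ k) * (p ∸ 1) ≡ p ^ k ∸ 1
      count-satisfiesSome = begin
        count (satisfiesSome? (p ^ k) a) (p ^ k) * (p ∸ 1)
          ≡⟨ cong (_* (p ∸ 1)) (count-cong _ (classesUpTo? k) satisfiesSome≐classesUpTo (p ^ k)) ⟩
        count (classesUpTo? k) (p ^ k) * (p ∸ 1)         ≡⟨ sym (m+n∸n≡m _ 1) ⟩
        count (classesUpTo? k) (p ^ k) * (p ∸ 1) + 1 ∸ 1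
          ≡⟨ cong (_∸ 1) (count-classesUpTo {k} {0} (+-identityʳ k)) ⟩
        p ^ k ∸ 1                                        ∎
        where open ≡-Reasoning

proposition2 : (p k : ℕ) → Prime p → 1 ≤ k →
    NonIntersecting (p ^ k) ×
    (∀ (a : CongFamily) → IsCDSetOf (p ^ k) a →
      HasDensity (p ^ k) a ((+ (p ^ k ∸ 1)) ÷ (p ^ k * (p ∸ 1))))
proposition2 p k p-prime _ = (a₀ p-prime , a₀-isCD p-prime k) , density
  where
  instance
    p^k≢0 : NonZero (p ^ k)
    p^k≢0 = m^n≢0 p k {{prime⇒nonZero p-prime}}

  density : ∀ a → IsCDSetOf (p ^ k) a → HasDensity (p ^ k) a ((+ (p ^ k ∸ 1)) ÷ (p ^ k * (p ∸ 1)))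
  density a cd = ConvergesTo-cong (λ N → cong (λ c → (+ c) ÷ N) (sym (countA≡count (p ^ k) a N)))
    (periodic-density (satisfiesSome? (p ^ k) a) (satisfiesSome-periodic {p ^ k} {a})
      (m<n⇒0<n∸m (1<p p-prime)) (CDSetOfPrimePower.count-satisfiesSome p-prime k a cd))
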